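{- For every integer $r\ge 2$, ${\rm gp_{e}}(Q_r) = 2^r$.
   Context: $Q_r$ is the $r$-dimensional hypercube: vertex set $\{0,1\}^r$, two vertices adjacent iff they differ in exactly one coordinate. A geodesic is a shortest path. A set $S$ of edges of a graph $G$ is an edge general position set if no geodesic of $G$ contains three edges of $S$; ${\rm gp_{e}}(G)$ is the maximum cardinality of an edge general position set of $G$. -}

module Defs where

open import Data.Nat using (ℕ; zero; suc; _≤_; _^_)
open import Data.Bool using (Bool)
open import Data.Fin using (Fin)
open import Data.Vec using (Vec; lookup)
open import Data.List using (List; length)
open import Data.List.Membership.Propositional using (_∈_)
open import Data.List.Relation.Unary.AllPairs using (AllPairs)
open import Data.Product using (Σ; ∃; ∃-syntax; _×_; _,_)
open import Data.Sum using (_⊎_)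
open import Relation.Nullary using (¬_)
open import Relation.Binary.PropositionalEquality using (_≡_; _≢_)

record Graph : Set₁ where
  field
    V   : Set
    Adj : V → V → Set
open Graph public

Q : ℕ → Graph
Q r = record
  { V   = Vec Bool r
  ; Adj = λ u w → ∃[ i ] (lookup u i ≢ lookup w i
                           × (∀ j → j ≢ i → lookup u j ≡ lookup w j)) }

module _ (G : Graph) where
  private
    Vx = V G
    A  = Adj G

  data Walk : Vx → Vx → Set where
    [] : ∀ {u} → Walk u u
    step : ∀ {u w v} → A u w → Walk w v → Walk u v

  len : ∀ {u v} → Walk u v → ℕ
  len [] = zero
  len (step _ p) = suc (len p)

  Geodesic : ∀ {u v} → Walk u v → Set
  Geodesic {u} {v} p = ∀ (q : Walk u v) → len p ≤ len q

  -- An edge, given by its two endpoints (as an ordered pair, the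
  -- orientation being irrelevant; see SameEdge).
  Edge : Set
  Edge = Σ (Vx × Vx) (λ { (a , b) → A a b })

  endpoints : Edge → Vx × Vx
  endpoints (ab , _) = ab

  SameEdge : Edge → Edge → Set
  SameEdge e f with endpoints e | endpoints f
  ... | (a , b) | (c , d) = (a ≡ c × b ≡ d) ⊎ (a ≡ d × b ≡ c)

  data EdgeOn (e : Edge) : ∀ {u v} → Walk u v → Set where
    here  : ∀ {u w v} (x : A u w) (p : Walk w v) →
            SameEdge e ((u , w) , x) → EdgeOn e (step x p)
    there : ∀ {u w v} (x : A u w) (p : Walk w v) →
            EdgeOn e p → EdgeOn e (step x p)

  IsEdgeSet : List Edge → Set
  IsEdgeSet S = AllPairs (λ e f → ¬ SameEdge e f) S

  EdgeGeneralPosition : List Edge → Set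
  EdgeGeneralPosition S =
    ∀ {u v} (p : Walk u v) → Geodesic p →
      ¬ (∃[ e₁ ] ∃[ e₂ ] ∃[ e₃ ]
           (e₁ ∈ S × e₂ ∈ S × e₃ ∈ S
           × ¬ SameEdge e₁ e₂ × ¬ SameEdge e₁ e₃ × ¬ SameEdge e₂ e₃
           × EdgeOn e₁ p × EdgeOn e₂ p × EdgeOn e₃ p))

  GpeNumber : ℕ → Set
  GpeNumber k =
    (∃[ S ] (IsEdgeSet S × EdgeGeneralPosition S × length S ≡ k))
    × (∀ S → IsEdgeSet S → EdgeGeneralPosition S → length S ≤ k)

module Submission where

-- A geodesic of Q_r never flips the same coordinate twice: the two flips could be cancelled,
-- giving a shorter walk. Hence the 2^r edges in directions 0 and 1 are in general position.
-- Conversely, flipping the coordinates 0, 1, …, r − 1 in turn gives a geodesic from each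
-- vertex c to its antipode; an edge {a, b} in direction i lies on the one starting from a,
-- and on the one starting from b, with their first i coordinates complemented. These two
-- anchors differ in coordinate i, and each of the 2^r geodesics carries at most two edges of
-- a general position set S, so 2 |S| ≤ 2 · 2^r.

open import Defs
open import Data.Nat using (ℕ; zero; suc; _≤_; _<_; _^_; _+_; _*_; z≤n; s≤s)
open import Data.Nat.Properties
  using (≤-trans; ≤-reflexive; n<1+n; m<n⇒m<1+n; <⇒≱; +-mono-≤; +-monoˡ-≤; +-monoʳ-≤; +-suc; +-identityʳ;
         *-suc; *-cancelˡ-≤; module ≤-Reasoning)
open import Data.Bool using (Bool; true; false; not; _xor_; if_then_else_)
import Data.Bool as Bool
open import Data.Bool.Properties using (not-involutive; not-¬; ¬-not)
open import Data.Fin using (Fin; zero; suc; _≟_)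
open import Data.Vec using (Vec; []; _∷_; lookup; updateAt; tabulate)
import Data.Vec as Vec
open import Data.Vec.Properties
  using (≡-dec; ∷-injectiveʳ; updateAt-updateAt; updateAt-id-local; updateAt-commutes; lookup∘updateAt; lookup∘updateAt′;
         tabulate∘lookup; tabulate-cong)
open import Data.Product using (Σ-syntax; _,_; proj₁; proj₂)
open import Data.Sum using (_⊎_; inj₁; inj₂)
open import Data.Empty using (⊥-elim)
open import Function using (_∘_)
open import Data.List using (List; []; _∷_; length; map; _++_; filter; concatMap)
open import Data.List.Properties using (length-++; length-map)
open import Data.List.Membership.Propositional using (_∈_)
open import Data.List.Membership.Propositional.Properties using (∈-++⁺ˡ; ∈-++⁺ʳ; ∈-map⁺; ∈-filter⁻)
open import Data.List.Relation.Unary.Any using (here; there)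
open import Data.List.Relation.Unary.All as All using (All; []; _∷_)
import Data.List.Relation.Unary.All.Properties as All
open import Data.List.Relation.Unary.AllPairs as AllPairs using (AllPairs; []; _∷_)
open import Data.List.Relation.Binary.Sublist.Propositional.Properties using (filter-⊆; filter⁺; length-mono-≤)
import Data.List.Relation.Unary.AllPairs.Properties as AllPairs
open import Relation.Nullary using (¬_; yes; no)
open import Relation.Nullary.Decidable using (_⊎-dec_; ¬?)
open import Relation.Binary.Definitions using (DecidableEquality)
open import Relation.Unary using (Decidable)
open import Relation.Binary.PropositionalEquality

private
  variable
    r : ℕ

module _ {G : Graph} where

  SameEdge-sym : ∀ {e f} → SameEdge G e f → SameEdge G f e
  SameEdge-sym (inj₁ (refl , refl)) = inj₁ (refl , refl)
  SameEdge-sym (inj₂ (refl , refl)) = inj₂ (refl , refl)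

  SameEdge-trans : ∀ {e f g} → SameEdge G e f → SameEdge G f g → SameEdge G e g
  SameEdge-trans (inj₁ (refl , refl)) f≈g = f≈g
  SameEdge-trans (inj₂ (refl , refl)) (inj₁ (refl , refl)) = inj₂ (refl , refl)
  SameEdge-trans (inj₂ (refl , refl)) (inj₂ (refl , refl)) = inj₁ (refl , refl)

  EdgeOn-resp : ∀ {e f u v} {p : Walk G u v} → SameEdge G e f → EdgeOn G e p → EdgeOn G f p
  EdgeOn-resp {e} {f} e≈f (here x p e≈x) =
    here x p (SameEdge-trans {f} {e} {(_ , _) , x} (SameEdge-sym {e} {f} e≈f) e≈x)
  EdgeOn-resp e≈f (there x p o) = there x p (EdgeOn-resp e≈f o)

  EdgeGeneralPosition⇒≤2-on-geodesic :
    ∀ {S} → EdgeGeneralPosition G S → ∀ {u v} {p : Walk G u v} → Geodesic G p →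
    ∀ T → (∀ {e} → e ∈ T → e ∈ S) → IsEdgeSet G T → All (λ e → EdgeOn G e p) T → length T ≤ 2
  EdgeGeneralPosition⇒≤2-on-geodesic gp geodesic []          _    _ _ = z≤n
  EdgeGeneralPosition⇒≤2-on-geodesic gp geodesic (_ ∷ [])     _    _ _ = s≤s z≤n
  EdgeGeneralPosition⇒≤2-on-geodesic gp geodesic (_ ∷ _ ∷ []) _    _ _ = s≤s (s≤s z≤n)
  EdgeGeneralPosition⇒≤2-on-geodesic gp {p = p} geodesic (e₁ ∷ e₂ ∷ e₃ ∷ T) T⊆S
    ((e₁≉e₂ ∷ e₁≉e₃ ∷ _) ∷ (e₂≉e₃ ∷ _) ∷ _) (e₁∈p ∷ e₂∈p ∷ e₃∈p ∷ _) =
    ⊥-elim (gp p geodesic (e₁ , e₂ , e₃ , T⊆S (here refl) , T⊆S (there (here refl)) , T⊆S (there (there (here refl))) ,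
                           e₁≉e₂ , e₁≉e₃ , e₂≉e₃ , e₁∈p , e₂∈p , e₃∈p))

module _ {A B : Set} (f g : B → A) where

  pairs : List B → List A
  pairs = concatMap (λ x → f x ∷ g x ∷ [])

  length-pairs : ∀ xs → length (pairs xs) ≡ 2 * length xs
  length-pairs []       = refl
  length-pairs (x ∷ xs) = trans (cong (2 +_) (length-pairs xs)) (sym (*-suc 2 (length xs)))

length-map-++-map : ∀ {A B : Set} (f g : A → B) xs → length (map f xs ++ map g xs) ≡ 2 * length xs
length-map-++-map f g xs = begin
  length (map f xs ++ map g xs)         ≡⟨ length-++ (map f xs) ⟩
  length (map f xs) + length (map g xs) ≡⟨ cong₂ _+_ (length-map f xs) (length-map g xs) ⟩
  length xs + length xs                 ≡⟨ cong (length xs +_) (+-identityʳ (length xs)) ⟨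
  2 * length xs                         ∎
  where open ≡-Reasoning

module _ {A : Set} (_≟ᴬ_ : DecidableEquality A) where

  length-filter-split : ∀ (u : A) xs → length (filter (u ≟ᴬ_) xs) + length (filter (¬? ∘ (u ≟ᴬ_)) xs) ≡ length xs
  length-filter-split u []       = refl
  length-filter-split u (x ∷ xs) with u ≟ᴬ x
  ... | yes _ = cong suc (length-filter-split u xs)
  ... | no  _ = trans (+-suc _ _) (cong suc (length-filter-split u xs))

  length-≤-multiplicity : ∀ k (U L : List A) → (∀ {x} → x ∈ L → x ∈ U) →
                          (∀ u → length (filter (u ≟ᴬ_) L) ≤ k) → length L ≤ k * length U
  length-≤-multiplicity k []      []      _    _    = z≤n
  length-≤-multiplicity k []      (x ∷ L) L⊆[] _    with L⊆[] (here refl)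
  ... | ()
  length-≤-multiplicity k (u ∷ U) L       L⊆uU mult = begin
    length L                                                    ≡⟨ length-filter-split u L ⟨
    length (filter (u ≟ᴬ_) L) + length (filter (¬? ∘ (u ≟ᴬ_)) L) ≤⟨ +-mono-≤ (mult u) rest ⟩
    k + k * length U                                            ≡⟨ *-suc k (length U) ⟨
    k * length (u ∷ U)                                          ∎
    where
    open ≤-Reasoning
    L′ = filter (¬? ∘ (u ≟ᴬ_)) L
    L′⊆U : ∀ {x} → x ∈ L′ → x ∈ U
    L′⊆U x∈L′ with ∈-filter⁻ (¬? ∘ (u ≟ᴬ_)) x∈L′
    ... | x∈L , u≢x with L⊆uU x∈L
    ...   | here refl = ⊥-elim (u≢x refl)
    ...   | there x∈U = x∈U
    rest = length-≤-multiplicity k U L′ L′⊆U λ u′ →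
      ≤-trans (length-mono-≤ (filter⁺ (u′ ≟ᴬ_) (u′ ≟ᴬ_) (λ { refl p → p }) (filter-⊆ _ L))) (mult u′)

  occurrences-in-pairs : ∀ {B : Set} (f g : B → A) → (∀ x → f x ≢ g x) → ∀ v xs →
    length (filter (v ≟ᴬ_) (pairs f g xs)) ≤ length (filter (λ x → (v ≟ᴬ f x) ⊎-dec (v ≟ᴬ g x)) xs)
  occurrences-in-pairs f g f≢g v []       = z≤n
  occurrences-in-pairs f g f≢g v (x ∷ xs) with v ≟ᴬ f x
  ... | yes refl with v ≟ᴬ g x
  ...   | yes v≡gx = ⊥-elim (f≢g x v≡gx)
  ...   | no  _    = s≤s (occurrences-in-pairs f g f≢g v xs)
  occurrences-in-pairs f g f≢g v (x ∷ xs) | no _ with v ≟ᴬ g x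
  ...   | yes _    = s≤s (occurrences-in-pairs f g f≢g v xs)
  ...   | no  _    = occurrences-in-pairs f g f≢g v xs

pigeonhole : ∀ {A : Set} {i j x y z : A} → x ≡ i ⊎ x ≡ j → y ≡ i ⊎ y ≡ j → z ≡ i ⊎ z ≡ j →
             x ≡ y ⊎ x ≡ z ⊎ y ≡ z
pigeonhole (inj₁ refl) (inj₁ refl) _           = inj₁ refl
pigeonhole (inj₂ refl) (inj₂ refl) _           = inj₁ refl
pigeonhole (inj₁ refl) (inj₂ refl) (inj₁ refl) = inj₂ (inj₁ refl)
pigeonhole (inj₂ refl) (inj₁ refl) (inj₂ refl) = inj₂ (inj₁ refl)
pigeonhole (inj₁ refl) (inj₂ refl) (inj₂ refl) = inj₂ (inj₂ refl)
pigeonhole (inj₂ refl) (inj₁ refl) (inj₁ refl) = inj₂ (inj₂ refl)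

flip : Fin r → Vec Bool r → Vec Bool r
flip i v = updateAt v i not

flip-involutive : ∀ (i : Fin r) v → flip i (flip i v) ≡ v
flip-involutive i v = trans (updateAt-updateAt i v) (updateAt-id-local i v (not-involutive _))

flip-sym : ∀ {i : Fin r} {u w} → w ≡ flip i u → u ≡ flip i w
flip-sym {i = i} {u = u} refl = sym (flip-involutive i u)

flip-comm : ∀ (i j : Fin r) v → flip i (flip j v) ≡ flip j (flip i v)
flip-comm i j v with i ≟ j
... | yes refl = refl
... | no  i≢j = updateAt-commutes i j i≢j v

flip-adjacent : ∀ (i : Fin r) v → Adj (Q r) v (flip i v)
flip-adjacent i v =
  i , (λ eq → not-¬ refl (trans eq (lookup∘updateAt i v))) ,
      (λ j j≢i → sym (lookup∘updateAt′ j i j≢i v))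

adjacent⇒flip : ∀ {u w : Vec Bool r} (x : Adj (Q r) u w) → w ≡ flip (proj₁ x) u
adjacent⇒flip {u = u} {w = w} (i , uᵢ≢wᵢ , rest) = begin
  w                            ≡⟨ tabulate∘lookup w ⟨
  tabulate (lookup w)          ≡⟨ tabulate-cong coordinate ⟩
  tabulate (lookup (flip i u)) ≡⟨ tabulate∘lookup (flip i u) ⟩
  flip i u                     ∎
  where
  open ≡-Reasoning
  coordinate : ∀ j → lookup w j ≡ lookup (flip i u) j
  coordinate j with j ≟ i
  ... | yes refl = trans (¬-not (λ eq → uᵢ≢wᵢ (sym eq))) (sym (lookup∘updateAt i u))
  ... | no  j≢i = trans (sym (rest j j≢i)) (sym (lookup∘updateAt′ j i j≢i u))

flip-preserves-Adj : ∀ (i : Fin r) {u w} → Adj (Q r) u w → Adj (Q r) (flip i u) (flip i w)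
flip-preserves-Adj i {u} {w} x@(k , _) =
  subst (Adj (Q _) (flip i u))
        (trans (flip-comm k i u) (cong (flip i) (sym (adjacent⇒flip {u = u} {w} x))))
        (flip-adjacent k (flip i u))

direction : Edge (Q r) → Fin r
direction (_ , (i , _)) = i

SameEdge-flip : ∀ (e : Edge (Q r)) {u w} {x : Adj (Q r) u w} →
                SameEdge (Q r) e ((u , w) , x) → w ≡ flip (direction e) u
SameEdge-flip ((a , b) , ab) (inj₁ (refl , refl)) = adjacent⇒flip {u = a} {b} ab
SameEdge-flip ((a , b) , ab) (inj₂ (refl , refl)) = flip-sym (adjacent⇒flip {u = a} {b} ab)

-- Flipping coordinate i on the part of p before its step along e removes that step.
shortcut : ∀ {e : Edge (Q r)} {i w v} (p : Walk (Q r) w v) → EdgeOn (Q r) e p → direction e ≡ i →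
           Σ[ q ∈ Walk (Q r) (flip i w) v ] len (Q r) q < len (Q r) p
shortcut {e = e} (step {u} {w} x p) (here .x .p e≈x) refl with SameEdge-flip e {u} {w} {x} e≈x
... | refl = p , n<1+n _
shortcut {i = i} (step {u} {w} x p) (there .x .p e∈p) dir =
  let q , q<p = shortcut p e∈p dir in step (flip-preserves-Adj i {u} {w} x) q , s≤s q<p

shorter-than-two-crossings :
  ∀ {e f : Edge (Q r)} {u v} (p : Walk (Q r) u v) → direction e ≡ direction f → ¬ SameEdge (Q r) e f →
  EdgeOn (Q r) e p → EdgeOn (Q r) f p → Σ[ q ∈ Walk (Q r) u v ] len (Q r) q < len (Q r) p
shorter-than-two-crossings {e = e} {f} (step {u} {w} x p) _ e≉f (here .x .p e≈x) (here .x .p f≈x) =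
  ⊥-elim (e≉f (SameEdge-trans {e = e} {(u , w) , x} {f} e≈x (SameEdge-sym {e = f} {(u , w) , x} f≈x)))
shorter-than-two-crossings {e = e} (step {u} {w} x p) dir _ (here .x .p e≈x) (there .x .p f∈p)
  with flip-sym {i = direction e} (SameEdge-flip e {u} {w} {x} e≈x)
... | refl = let q , q<p = shortcut p f∈p (sym dir) in q , m<n⇒m<1+n q<p
shorter-than-two-crossings {f = f} (step {u} {w} x p) dir _ (there .x .p e∈p) (here .x .p f≈x)
  with flip-sym {i = direction f} (SameEdge-flip f {u} {w} {x} f≈x)
... | refl = let q , q<p = shortcut p e∈p dir in q , m<n⇒m<1+n q<p
shorter-than-two-crossings (step x p) dir e≉f (there .x .p e∈p) (there .x .p f∈p) =
  let q , q<p = shorter-than-two-crossings p dir e≉f e∈p f∈p in step x q , s≤s q<p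

Geodesic⇒directions-distinct :
  ∀ {e f : Edge (Q r)} {u v} {p : Walk (Q r) u v} → Geodesic (Q r) p →
  EdgeOn (Q r) e p → EdgeOn (Q r) f p → ¬ SameEdge (Q r) e f → direction e ≢ direction f
Geodesic⇒directions-distinct {p = p} geodesic e∈p f∈p e≉f dir =
  let q , q<p = shorter-than-two-crossings p dir e≉f e∈p f∈p in <⇒≱ q<p (geodesic q)

twoDirections⇒EdgeGeneralPosition :
  ∀ {i j : Fin r} (S : List (Edge (Q r))) → All (λ e → direction e ≡ i ⊎ direction e ≡ j) S →
  EdgeGeneralPosition (Q r) S
twoDirections⇒EdgeGeneralPosition S dirs p geodesic
  (e₁ , e₂ , e₃ , e₁∈S , e₂∈S , e₃∈S , e₁≉e₂ , e₁≉e₃ , e₂≉e₃ , e₁∈p , e₂∈p , e₃∈p)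
  with pigeonhole (All.lookup dirs e₁∈S) (All.lookup dirs e₂∈S) (All.lookup dirs e₃∈S)
... | inj₁ d₁₂        = Geodesic⇒directions-distinct geodesic e₁∈p e₂∈p e₁≉e₂ d₁₂
... | inj₂ (inj₁ d₁₃) = Geodesic⇒directions-distinct geodesic e₁∈p e₃∈p e₁≉e₃ d₁₃
... | inj₂ (inj₂ d₂₃) = Geodesic⇒directions-distinct geodesic e₂∈p e₃∈p e₂≉e₃ d₂₃

vertices : ∀ r → List (Vec Bool r)
vertices zero    = [] ∷ []
vertices (suc r) = map (true ∷_) (vertices r) ++ map (false ∷_) (vertices r)

length-vertices : ∀ r → length (vertices r) ≡ 2 ^ r
length-vertices zero    = refl
length-vertices (suc r) =
  trans (length-map-++-map (true ∷_) (false ∷_) (vertices r)) (cong (2 *_) (length-vertices r))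

∈-vertices : ∀ (v : Vec Bool r) → v ∈ vertices r
∈-vertices []          = here refl
∈-vertices (true ∷ v)  = ∈-++⁺ˡ (∈-map⁺ (true ∷_) (∈-vertices v))
∈-vertices (false ∷ v) = ∈-++⁺ʳ _ (∈-map⁺ (false ∷_) (∈-vertices v))

vertices-unique : ∀ r → AllPairs _≢_ (vertices r)
vertices-unique zero    = [] ∷ []
vertices-unique (suc r) =
  AllPairs.++⁺ (AllPairs.map⁺ (AllPairs.map cons-injective (vertices-unique r)))
               (AllPairs.map⁺ (AllPairs.map cons-injective (vertices-unique r)))
               (All.map⁺ (All.universal (λ _ → All.map⁺ (All.universal (λ _ ()) _)) _))
  where
  cons-injective : ∀ {x : Bool} {v w : Vec Bool r} → v ≢ w → x ∷ v ≢ x ∷ w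
  cons-injective v≢w eq = v≢w (∷-injectiveʳ eq)

_≟ᵛ_ : DecidableEquality (Vec Bool r)
_≟ᵛ_ = ≡-dec Bool._≟_

flipEdge : Fin r → Vec Bool r → Edge (Q r)
flipEdge i v = (v , flip i v) , flip-adjacent i v

module _ {n : ℕ} where

  firstDirectionEdge : Vec Bool (suc n) → Edge (Q (2 + n))
  firstDirectionEdge w = flipEdge zero (false ∷ w)

  secondDirectionEdge : Vec Bool (suc n) → Edge (Q (2 + n))
  secondDirectionEdge (x ∷ w) = flipEdge (suc zero) (x ∷ false ∷ w)

  firstDirectionEdge-injective : ∀ {v w} → v ≢ w → ¬ SameEdge (Q (2 + n)) (firstDirectionEdge v) (firstDirectionEdge w)
  firstDirectionEdge-injective v≢w (inj₁ (refl , _)) = v≢w refl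
  firstDirectionEdge-injective v≢w (inj₂ (() , _))

  secondDirectionEdge-injective : ∀ {v w} → v ≢ w → ¬ SameEdge (Q (2 + n)) (secondDirectionEdge v) (secondDirectionEdge w)
  secondDirectionEdge-injective {_ ∷ _} {_ ∷ _} v≢w (inj₁ (refl , _)) = v≢w refl
  secondDirectionEdge-injective {_ ∷ _} {_ ∷ _} v≢w (inj₂ (() , _))

  first≉secondDirectionEdge : ∀ v w → ¬ SameEdge (Q (2 + n)) (firstDirectionEdge v) (secondDirectionEdge w)
  first≉secondDirectionEdge _ (_ ∷ _) (inj₁ (refl , ()))
  first≉secondDirectionEdge _ (_ ∷ _) (inj₂ (refl , ()))

twoDirectionEdges : ∀ n → List (Edge (Q (2 + n)))
twoDirectionEdges n = map firstDirectionEdge (vertices (suc n)) ++ map secondDirectionEdge (vertices (suc n))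

twoDirectionEdges-IsEdgeSet : ∀ n → IsEdgeSet (Q (2 + n)) (twoDirectionEdges n)
twoDirectionEdges-IsEdgeSet n =
  AllPairs.++⁺ (AllPairs.map⁺ (AllPairs.map firstDirectionEdge-injective (vertices-unique (suc n))))
               (AllPairs.map⁺ (AllPairs.map secondDirectionEdge-injective (vertices-unique (suc n))))
               (All.map⁺ (All.universal (λ v → All.map⁺ (All.universal (first≉secondDirectionEdge v) _)) _))

twoDirectionEdges-directions :
  ∀ n → All (λ e → direction e ≡ zero ⊎ direction e ≡ suc zero) (twoDirectionEdges n)
twoDirectionEdges-directions n =
  All.++⁺ (All.map⁺ {f = firstDirectionEdge} (All.universal (λ _ → inj₁ refl) (vertices (suc n))))
          (All.map⁺ {f = secondDirectionEdge} (All.universal (λ { (_ ∷ _) → inj₂ refl }) (vertices (suc n))))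

length-twoDirectionEdges : ∀ n → length (twoDirectionEdges n) ≡ 2 ^ (2 + n)
length-twoDirectionEdges n =
  trans (length-map-++-map firstDirectionEdge secondDirectionEdge (vertices (suc n)))
        (cong (2 *_) (length-vertices (suc n)))

liftAdj : ∀ (z : Bool) {u w : Vec Bool r} → Adj (Q r) u w → Adj (Q (suc r)) (z ∷ u) (z ∷ w)
liftAdj z (i , uᵢ≢wᵢ , rest) =
  suc i , uᵢ≢wᵢ , λ { zero _ → refl ; (suc j) j≢i → rest j (λ eq → j≢i (cong suc eq)) }

liftWalk : ∀ (z : Bool) {u w : Vec Bool r} → Walk (Q r) u w → Walk (Q (suc r)) (z ∷ u) (z ∷ w)
liftWalk z []                 = []
liftWalk z (step {u} {w} x p) = step (liftAdj z {u} {w} x) (liftWalk z p)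

len-liftWalk : ∀ (z : Bool) {u w : Vec Bool r} (p : Walk (Q r) u w) → len (Q (suc r)) (liftWalk z p) ≡ len (Q r) p
len-liftWalk z []         = refl
len-liftWalk z (step x p) = cong suc (len-liftWalk z p)

EdgeOn-flipEdge-liftWalk : ∀ (z : Bool) {i : Fin r} {a u v} {p : Walk (Q r) u v} →
  EdgeOn (Q r) (flipEdge i a) p → EdgeOn (Q (suc r)) (flipEdge (suc i) (z ∷ a)) (liftWalk z p)
EdgeOn-flipEdge-liftWalk z (here x p (inj₁ (refl , refl))) = here _ _ (inj₁ (refl , refl))
EdgeOn-flipEdge-liftWalk z (here x p (inj₂ (refl , refl))) = here _ _ (inj₂ (refl , refl))
EdgeOn-flipEdge-liftWalk z (there x p a∈p)                 = there _ _ (EdgeOn-flipEdge-liftWalk z a∈p)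

complement : Vec Bool r → Vec Bool r
complement = Vec.map not

antipodalWalk : (v : Vec Bool r) → Walk (Q r) v (complement v)
antipodalWalk []      = []
antipodalWalk (x ∷ v) = step (flip-adjacent zero (x ∷ v)) (liftWalk (not x) (antipodalWalk v))

len-antipodalWalk : ∀ (v : Vec Bool r) → len (Q r) (antipodalWalk v) ≡ r
len-antipodalWalk []      = refl
len-antipodalWalk (x ∷ v) = cong suc (trans (len-liftWalk (not x) (antipodalWalk v)) (len-antipodalWalk v))

hamming : Vec Bool r → Vec Bool r → ℕ
hamming []      []      = 0
hamming (x ∷ u) (y ∷ w) = (if x xor y then 1 else 0) + hamming u w

hamming-self : ∀ (v : Vec Bool r) → hamming v v ≡ 0
hamming-self []          = refl
hamming-self (true ∷ v)  = hamming-self v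
hamming-self (false ∷ v) = hamming-self v

hamming-complement : ∀ (v : Vec Bool r) → hamming v (complement v) ≡ r
hamming-complement []          = refl
hamming-complement (true ∷ v)  = cong suc (hamming-complement v)
hamming-complement (false ∷ v) = cong suc (hamming-complement v)

hamming-flip : ∀ (i : Fin r) u w → hamming (flip i u) w ≤ suc (hamming u w)
hamming-flip zero (x ∷ u) (y ∷ w) = +-monoˡ-≤ (hamming u w) (bit x y)
  where
  bit : ∀ x y → (if not x xor y then 1 else 0) ≤ suc (if x xor y then 1 else 0)
  bit true  true  = s≤s z≤n
  bit true  false = z≤n
  bit false true  = z≤n
  bit false false = s≤s z≤n
hamming-flip (suc i) (x ∷ u) (y ∷ w) =
  ≤-trans (+-monoʳ-≤ (if x xor y then 1 else 0) (hamming-flip i u w))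
          (≤-reflexive (+-suc (if x xor y then 1 else 0) (hamming u w)))

hamming-≤-len : ∀ {u w : Vec Bool r} (p : Walk (Q r) u w) → hamming u w ≤ len (Q r) p
hamming-≤-len {u = u} [] = ≤-reflexive (hamming-self u)
hamming-≤-len {u = u} {t} (step {w = w} x@(i , _) p) with flip-sym {i = i} (adjacent⇒flip {u = u} {w} x)
... | refl = ≤-trans (hamming-flip i w t) (s≤s (hamming-≤-len p))

antipodalWalk-geodesic : ∀ (v : Vec Bool r) → Geodesic (Q r) (antipodalWalk v)
antipodalWalk-geodesic {r} v q = begin
  len (Q r) (antipodalWalk v) ≡⟨ len-antipodalWalk v ⟩
  r                           ≡⟨ hamming-complement v ⟨
  hamming v (complement v)    ≤⟨ hamming-≤-len q ⟩
  len (Q r) q                 ∎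
  where open ≤-Reasoning

complementPrefix : Fin r → Vec Bool r → Vec Bool r
complementPrefix zero    v       = v
complementPrefix (suc i) (x ∷ v) = not x ∷ complementPrefix i v

lookup-complementPrefix : ∀ (i : Fin r) v → lookup (complementPrefix i v) i ≡ lookup v i
lookup-complementPrefix zero    (x ∷ v) = refl
lookup-complementPrefix (suc i) (x ∷ v) = lookup-complementPrefix i v

antipodalWalk-flipEdge : ∀ (i : Fin r) a → EdgeOn (Q r) (flipEdge i a) (antipodalWalk (complementPrefix i a))
antipodalWalk-flipEdge zero    (x ∷ a)     = here _ _ (inj₁ (refl , refl))
antipodalWalk-flipEdge (suc i) (true ∷ a)  = there _ _ (EdgeOn-flipEdge-liftWalk true (antipodalWalk-flipEdge i a))
antipodalWalk-flipEdge (suc i) (false ∷ a) = there _ _ (EdgeOn-flipEdge-liftWalk false (antipodalWalk-flipEdge i a))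

anchorˡ anchorʳ : Edge (Q r) → Vec Bool r
anchorˡ e@((a , _) , _) = complementPrefix (direction e) a
anchorʳ e@((_ , b) , _) = complementPrefix (direction e) b

anchorˡ≢anchorʳ : ∀ (e : Edge (Q r)) → anchorˡ e ≢ anchorʳ e
anchorˡ≢anchorʳ ((a , b) , (i , aᵢ≢bᵢ , _)) eq =
  aᵢ≢bᵢ (trans (sym (lookup-complementPrefix i a))
              (trans (cong (λ c → lookup c i) eq) (lookup-complementPrefix i b)))

AnchoredAt : Vec Bool r → Edge (Q r) → Set
AnchoredAt v e = v ≡ anchorˡ e ⊎ v ≡ anchorʳ e

anchoredAt? : ∀ (v : Vec Bool r) → Decidable (AnchoredAt v)
anchoredAt? v e = (v ≟ᵛ anchorˡ e) ⊎-dec (v ≟ᵛ anchorʳ e)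

anchored⇒EdgeOn-antipodalWalk : ∀ {v} (e : Edge (Q r)) → AnchoredAt v e →
                                EdgeOn (Q r) e (antipodalWalk v)
anchored⇒EdgeOn-antipodalWalk ((a , b) , ab@(i , _)) (inj₁ refl) =
  EdgeOn-resp (inj₁ (refl , sym (adjacent⇒flip {u = a} {b} ab))) (antipodalWalk-flipEdge i a)
anchored⇒EdgeOn-antipodalWalk ((a , b) , ab@(i , _)) (inj₂ refl) =
  EdgeOn-resp (inj₂ (refl , sym (flip-sym {i = i} (adjacent⇒flip {u = a} {b} ab)))) (antipodalWalk-flipEdge i b)

length-anchoredAt-≤2 : ∀ {S : List (Edge (Q r))} → IsEdgeSet (Q r) S → EdgeGeneralPosition (Q r) S →
                       ∀ v → length (filter (anchoredAt? v) S) ≤ 2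
length-anchoredAt-≤2 {S = S} S-set S-gp v =
  EdgeGeneralPosition⇒≤2-on-geodesic S-gp (antipodalWalk-geodesic v) (filter (anchoredAt? v) S)
    (λ e∈T → proj₁ (∈-filter⁻ (anchoredAt? v) {xs = S} e∈T))
    (AllPairs.filter⁺ (anchoredAt? v) S-set)
    (All.tabulate (λ e∈T → anchored⇒EdgeOn-antipodalWalk _ (proj₂ (∈-filter⁻ (anchoredAt? v) {xs = S} e∈T))))

EdgeGeneralPosition⇒length≤2^r : ∀ r (S : List (Edge (Q r))) → IsEdgeSet (Q r) S → EdgeGeneralPosition (Q r) S →
                                 length S ≤ 2 ^ r
EdgeGeneralPosition⇒length≤2^r r S S-set S-gp = *-cancelˡ-≤ 2 (begin
  2 * length S                    ≡⟨ length-pairs anchorˡ anchorʳ S ⟨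
  length (pairs anchorˡ anchorʳ S)
    ≤⟨ length-≤-multiplicity _≟ᵛ_ 2 (vertices r) (pairs anchorˡ anchorʳ S) (λ _ → ∈-vertices _) multiplicity ⟩
  2 * length (vertices r)         ≡⟨ cong (2 *_) (length-vertices r) ⟩
  2 * 2 ^ r                       ∎)
  where
  open ≤-Reasoning
  multiplicity : ∀ v → length (filter (v ≟ᵛ_) (pairs anchorˡ anchorʳ S)) ≤ 2
  multiplicity v = ≤-trans (occurrences-in-pairs _≟ᵛ_ anchorˡ anchorʳ anchorˡ≢anchorʳ v S)
                            (length-anchoredAt-≤2 S-set S-gp v)

theorem3p2 : ∀ (r : ℕ) → 2 ≤ r → GpeNumber (Q r) (2 ^ r)
theorem3p2 (suc (suc n)) _ =
  ( twoDirectionEdges n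
  , twoDirectionEdges-IsEdgeSet n
  , twoDirections⇒EdgeGeneralPosition (twoDirectionEdges n) (twoDirectionEdges-directions n)
  , length-twoDirectionEdges n )
  , EdgeGeneralPosition⇒length≤2^r (suc (suc n))
theorem3p2 (suc zero) (s≤s ())
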